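{- For all $n,k\ge 1$, the sequence $D(n,k)$ is an $(n,k)$-De Bruijn sequence.
   Context: Words are finite sequences of symbols from $[k]=\{0,1,\dots,k-1\}$; $\sigma^t$ denotes $t$ repetitions of $\sigma$ ($\sigma^0$ is the empty word), $|w|$ is the length of $w$. A rotation of a word $xy$ is the word $yx$. For words of equal length, $w_1\le_{\mathrm{colex}} w_2$ means that the reversal of $w_1$ is lexicographically $\le$ the reversal of $w_2$; equivalently $w_1=w_2$, or $w_1=y_1\sigma x$ and $w_2=y_2\tau x$ with symbols $\sigma<\tau$. Fix $n\ge1$. A key-word is a word of length $n$ that is $\le_{\mathrm{colex}}$-maximal among its rotations. Let $c(n,k)$ be the number of key-words in $[k]^n$, and list them in increasing colex order $\mathrm{key}_0<_{\mathrm{colex}}\mathrm{key}_1<_{\mathrm{colex}}\cdots<_{\mathrm{colex}}\mathrm{key}_{c(n,k)-1}$ (so $\mathrm{key}_0=0^n$). Cycles: $C_0=(0^n)$ and $\mathrm{first}(C_0)=\mathrm{last}(C_0)=\mathrm{key}(C_0)=0^n$. For $m\ge1$ write $\mathrm{key}_m=0^l(\sigma+1)w$ with $l\ge0$ and $\sigma$ a symbol; $C_m$ is the sequence of all distinct rotations of $\mathrm{key}_m$ which starts with $\mathrm{first}(C_m)=w0^l(\sigma+1)$, in which each word $\tau w'$ ($\tau$ a symbol) is followed by $w'\tau$, and which ends with $\mathrm{last}(C_m)=(\sigma+1)w0^l$; also $\mathrm{key}(C_m)=\mathrm{key}_m$. Construction: $D_0=(0^n)$; for $0\le m<c(n,k)-1$,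 writing $\mathrm{key}_{m+1}=0^l(\sigma+1)w$, the sequence $D_{m+1}$ is obtained from $D_m$ by inserting the whole sequence $C_{m+1}$ (in its order) immediately after the word $\sigma w0^l$ (which already occurs in $D_m$). Set $D(n,k)=D_{c(n,k)-1}$. An $(n,k)$-De Bruijn sequence is a total ordering (listing) of all of $[k]^n$ such that (1) every word of the form $\tau w$ ($\tau$ a symbol) that is not last is immediately followed by a word of the form $w\sigma$, and (2) if the last word is $\tau x$ then the first word is of the form $x\sigma$. -}

module Defs where

open import Data.Nat using (ℕ; zero; suc; _≤_; z≤n; s≤s)
open import Data.Fin using (Fin; inject₁) renaming (zero to fzero; suc to fsuc; _<_ to _<ᶠ_)
import Data.Fin as Fin
open import Data.List using (List; []; _∷_; _++_; _∷ʳ_; length; replicate; head; last)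
open import Data.List.Properties using (≡-dec)
open import Data.List.Relation.Unary.Linked using (Linked)
open import Data.List.Relation.Unary.Unique.Propositional using (Unique)
open import Data.List.Membership.Propositional using (_∈_)
open import Data.Maybe using (Maybe; just; nothing)
import Data.Maybe as Maybe
open import Data.Product using (Σ; ∃; _×_; _,_)
open import Data.Sum using (_⊎_)
open import Relation.Binary.PropositionalEquality using (_≡_)
open import Relation.Nullary using (yes; no)
open import Function.Bundles using (_⇔_)

-- Words over the alphabet [k] = Fin k are lists; all words of interest have length n.
Word : ℕ → Set
Word k = List (Fin k)

_≤colex_ : ∀ {k} → Word k → Word k → Set
w₁ ≤colex w₂ = length w₁ ≡ length w₂ ×
  (w₁ ≡ w₂ ⊎ (∃ λ y₁ → ∃ λ y₂ → ∃ λ σ → ∃ λ τ → ∃ λ x →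
     w₁ ≡ y₁ ++ (σ ∷ x) × w₂ ≡ y₂ ++ (τ ∷ x) × σ <ᶠ τ))

_<colex_ : ∀ {k} → Word k → Word k → Set
w₁ <colex w₂ = w₁ ≤colex w₂ × (w₁ ≡ w₂ → Data.Empty.⊥)
  where import Data.Empty

IsKeyWord : ∀ {k} → ℕ → Word k → Set
IsKeyWord n w = length w ≡ n × (∀ x y → w ≡ x ++ y → (y ++ x) ≤colex w)

IsKeyList : ∀ {k} → ℕ → List (Word k) → Set
IsKeyList n keys = Linked _<colex_ keys × (∀ w → (w ∈ keys) ⇔ IsKeyWord n w)

rotL : ∀ {k} → Word k → Word k
rotL []       = []
rotL (x ∷ xs) = xs ∷ʳ x

-- the cycle of all distinct rotations of f, starting at f, each word followed by its left rotation
cycleFrom : ∀ {k} → Word k → List (Word k)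
cycleFrom {k} f = f ∷ go (length f) (rotL f)
  where
  go : ℕ → Word k → List (Word k)
  go zero    g = []
  go (suc i) g with ≡-dec Fin._≟_ g f
  ... | yes _ = []
  ... | no  _ = g ∷ go i (rotL g)

-- decomposition of a word as 0^l (σ+1) w; returns (l , σ' , w) where σ+1 = fsuc σ' and σ = inject₁ σ'
decomp : ∀ {k} → Word (suc k) → Maybe (ℕ × Fin k × Word (suc k))
decomp []           = nothing
decomp (fzero ∷ xs) = Maybe.map (λ { (l , s , w) → (suc l , s , w) }) (decomp xs)
decomp (fsuc s ∷ xs) = just (0 , s , xs)

insertAfter : ∀ {A : Set} → ((a b : A) → Relation.Nullary.Dec (a ≡ b)) →
              A → List A → List A → Maybe (List A)
insertAfter eq t c []       = nothing
insertAfter eq t c (x ∷ xs) with eq x t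
... | yes _ = just (x ∷ (c ++ xs))
... | no  _ = Maybe.map (x ∷_) (insertAfter eq t c xs)

-- one step D_m ↦ D_{m+1}, for key_{m+1} = 0^l (σ+1) w:
-- insert C_{m+1} (first = w 0^l (σ+1)) right after σ w 0^l
stepD : ∀ {k} → Maybe (List (Word (suc k))) → Word (suc k) → Maybe (List (Word (suc k)))
stepD nothing  key = nothing
stepD {k} (just D) key with decomp key
... | nothing = nothing
... | just (l , s , w) =
  insertAfter (≡-dec Fin._≟_) (inject₁ s ∷ (w ++ replicate l fzero))
              (cycleFrom ((w ++ replicate l fzero) ∷ʳ fsuc s)) D

-- D(n,k) built from the key list key_0, key_1, ... : D_0 = (0^n), then insert C_1, C_2, ...
-- (nothing = some insertion point did not occur)
buildD : ∀ {k} → 1 ≤ k → ℕ → List (Word k) → Maybe (List (Word k))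
buildD (s≤s z≤n) n []            = nothing
buildD (s≤s z≤n) n (key₀ ∷ rest) = go (just (replicate n fzero ∷ [])) rest
  where
  go : ∀ {k} → Maybe (List (Word (suc k))) → List (Word (suc k)) → Maybe (List (Word (suc k)))
  go D []         = D
  go D (ky ∷ kys) = go (stepD D ky) kys

Follows : ∀ {k} → Word k → Word k → Set
Follows u v = ∃ λ τ → ∃ λ w → ∃ λ σ → u ≡ τ ∷ w × v ≡ w ∷ʳ σ

IsDeBruijn : ∀ {k} → ℕ → List (Word k) → Set
IsDeBruijn n D =
  Unique D ×
  (∀ w → (w ∈ D) ⇔ (length w ≡ n)) ×
  Linked Follows D ×
  (∀ f l → head D ≡ just f → last D ≡ just l → Follows l f)

-- Every word of length n is a rotation of exactly one key-word, and D(n,k) splices in the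
-- rotation cycles of the key-words in colex order. Invariant: D_m lists, without repetition,
-- exactly the rotations of key_0, …, key_m, starts with 0ⁿ, and each word (the last one
-- cyclically) is followed by a shift of it. For key_{m+1} = 0ˡ(σ+1)w, every rotation of the
-- insertion point σw0ˡ arises from a rotation of key_{m+1} by lowering one symbol, so it is
-- colex-smaller than key_{m+1}; hence its key-word came earlier and σw0ˡ already occurs.
-- The cycle runs from w0ˡ(σ+1), a shift of σw0ˡ, to (σ+1)w0ˡ, which differs from σw0ˡ only in
-- its first symbol and so has the same successors. The spliced words are new because the
-- rotation classes of distinct key-words are disjoint.
module Submission where

open import Defs
open import Data.Nat using (ℕ; zero; suc; _+_; _*_; _≤_; _<_; z≤n; s≤s; NonZero)
import Data.Nat.Properties as ℕ
open import Data.Nat.DivMod using (_%_; _/_; m≡m%n+[m/n]*n; m%n<n)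
open import Data.Fin using (Fin; inject₁) renaming (zero to fzero; suc to fsuc; _<_ to _<ᶠ_)
import Data.Fin as Fin
import Data.Fin.Properties as FinP
open import Data.List using (List; []; _∷_; _++_; _∷ʳ_; length; replicate; reverse; last; head; applyUpTo; foldl)
open import Data.List.Properties
  using (≡-dec; ++-assoc; ++-identityʳ; length-++; ∷ʳ-injective; reverse-++; reverse-involutive; reverse-injective;
         length-reverse; unfold-reverse; length-replicate)
open import Data.List.Relation.Binary.Lex.Strict using (Lex-<; base; halt; this; next; <-transitive; <-irreflexive; <-compare)
open import Data.List.Relation.Binary.Pointwise using (Pointwise-≡⇒≡; ≡⇒Pointwise-≡)
open import Data.List.Membership.Propositional using (_∈_)
open import Data.List.Membership.Propositional.Properties using (∈-++⁺ˡ; ∈-++⁺ʳ; ∈-++⁻; ∈-applyUpTo⁺; ∈-applyUpTo⁻)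
open import Data.List.Relation.Unary.Any using (here; there)
open import Data.List.Relation.Unary.All using (All; []; _∷_)
import Data.List.Relation.Unary.All as All
open import Data.List.Relation.Unary.AllPairs using (AllPairs; []; _∷_)
open import Data.List.Relation.Unary.Unique.Propositional using (Unique)
import Data.List.Relation.Unary.Unique.Propositional.Properties as Unique
open import Data.List.Relation.Unary.Linked using (Linked; []; [-]; _∷_)
import Data.List.Relation.Unary.Linked as Linked
import Data.List.Relation.Unary.Linked.Properties as Linkedₚ
open import Data.List.Relation.Binary.Permutation.Propositional using (_↭_; ↭-sym; ↭⇒↭ₛ; module PermutationReasoning)
import Data.List.Relation.Binary.Permutation.Propositional.Properties as Perm
import Data.List.Relation.Binary.Permutation.Setoid.Properties as PermSetoid
open import Data.Maybe using (Maybe; just; nothing)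
import Data.Maybe as Maybe
open import Data.Maybe.Relation.Binary.Connected using (Connected; just; just-nothing)
open import Data.Product using (∃; _×_; _,_; proj₁; proj₂)
open import Data.Sum using (_⊎_; inj₁; inj₂)
open import Data.Empty using (⊥; ⊥-elim)
open import Function using (_∘_)
open import Function.Bundles using (_⇔_; mk⇔; Equivalence)
open import Relation.Nullary using (¬_; Dec; yes; no)
open import Relation.Binary.Definitions using (Tri; tri<; tri≈; tri>)
open import Relation.Binary.PropositionalEquality

private
  variable
    k : ℕ

extend-< : {P : ℕ → Set} {N : ℕ} → (∀ j → j < N → P j) → P N → ∀ j → j < suc N → P j
extend-< below top j (s≤s j≤N) with ℕ.m≤n⇒m<n∨m≡n j≤N
... | inj₁ j<N = below j j<N
... | inj₂ refl = top

least-witness : {P : ℕ → Set} → (∀ j → Dec (P j)) → ∀ {N} → P N →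
  ∃ λ d → d ≤ N × P d × ∀ j → j < d → ¬ P j
least-witness {P = P} P? {N} pN = scan 0 N refl (λ _ ())
  where
  scan : ∀ i fuel → i + fuel ≡ N → (∀ j → j < i → ¬ P j) → ∃ λ d → d ≤ N × P d × ∀ j → j < d → ¬ P j
  scan i fuel i+fuel≡N below with P? i
  ... | yes pi = i , subst (i ≤_) i+fuel≡N (ℕ.m≤m+n i fuel) , pi , below
  scan i zero i+0≡N below | no ¬pi =
    ⊥-elim (¬pi (subst P (trans (sym i+0≡N) (ℕ.+-identityʳ i)) pN))
  scan i (suc fuel) i+fuel≡N below | no ¬pi =
    scan (suc i) fuel (trans (sym (ℕ.+-suc i fuel)) i+fuel≡N) (extend-< below ¬pi)

-- Rotations

rot : ℕ → Word k → Word k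
rot zero    u = u
rot (suc i) u = rot i (rotL u)

rot-+ : ∀ i j (u : Word k) → rot (i + j) u ≡ rot j (rot i u)
rot-+ zero    j u = refl
rot-+ (suc i) j u = rot-+ i j (rotL u)

rot-comm : ∀ i j (u : Word k) → rot i (rot j u) ≡ rot j (rot i u)
rot-comm i j u = trans (sym (rot-+ j i u)) (trans (cong (λ m → rot m u) (ℕ.+-comm j i)) (rot-+ i j u))

rot-suc : ∀ i (u : Word k) → rot (suc i) u ≡ rotL (rot i u)
rot-suc i u = trans (cong (λ m → rot m u) (ℕ.+-comm 1 i)) (rot-+ i 1 u)

rot-[] : ∀ i → rot {k} i [] ≡ []
rot-[] zero    = refl
rot-[] (suc i) = rot-[] i

length-rotL : (u : Word k) → length (rotL u) ≡ length u
length-rotL []       = refl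
length-rotL (c ∷ u) = trans (length-++ u) (ℕ.+-comm (length u) 1)

length-rot : ∀ i (u : Word k) → length (rot i u) ≡ length u
length-rot zero    u = refl
length-rot (suc i) u = trans (length-rot i (rotL u)) (length-rotL u)

rot-++ : (x y : Word k) → rot (length x) (x ++ y) ≡ y ++ x
rot-++ []      y = sym (++-identityʳ y)
rot-++ (c ∷ x) y = begin
  rot (length x) ((x ++ y) ∷ʳ c)   ≡⟨ cong (rot (length x)) (++-assoc x y (c ∷ [])) ⟩
  rot (length x) (x ++ (y ∷ʳ c))   ≡⟨ rot-++ x (y ∷ʳ c) ⟩
  (y ∷ʳ c) ++ x                    ≡⟨ ++-assoc y (c ∷ []) x ⟩
  y ++ c ∷ x                       ∎
  where open ≡-Reasoning

rot-length : (u : Word k) → rot (length u) u ≡ u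
rot-length u = trans (cong (rot (length u)) (sym (++-identityʳ u))) (rot-++ u [])

rot-*-period : ∀ {p} {u : Word k} → rot p u ≡ u → ∀ q → rot (q * p) u ≡ u
rot-*-period         period zero    = refl
rot-*-period {p = p} {u} period (suc q) =
  trans (rot-+ p (q * p) u) (trans (cong (rot (q * p)) period) (rot-*-period period q))

rot-%-period : ∀ {p} .{{_ : NonZero p}} {u : Word k} → rot p u ≡ u → ∀ j → rot j u ≡ rot (j % p) u
rot-%-period {p = p} {u} period j = begin
  rot j u                                  ≡⟨ cong (λ m → rot m u) (m≡m%n+[m/n]*n j p) ⟩
  rot (j % p + j / p * p) u                ≡⟨ rot-+ (j % p) (j / p * p) u ⟩
  rot (j / p * p) (rot (j % p) u)          ≡⟨ rot-comm (j / p * p) (j % p) u ⟩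
  rot (j % p) (rot (j / p * p) u)          ≡⟨ cong (rot (j % p)) (rot-*-period period (j / p)) ⟩
  rot (j % p) u                            ∎
  where open ≡-Reasoning

rot-split : ∀ i (u : Word k) → ∃ λ x → ∃ λ y → u ≡ x ++ y × rot i u ≡ y ++ x
rot-split zero u = [] , u , refl , sym (++-identityʳ u)
rot-split (suc i) u rewrite rot-suc i u with rot-split i u
... | [] , [] , refl , r = [] , [] , refl , cong rotL r
... | c ∷ x , [] , refl , r = c ∷ [] , x , cong (c ∷_) (++-identityʳ x) , cong rotL r
... | x , c ∷ y , refl , r = x ∷ʳ c , y , sym (++-assoc x (c ∷ []) y) , trans (cong rotL r) (++-assoc y x (c ∷ []))

rotL-injective : {u v : Word k} → rotL u ≡ rotL v → u ≡ v
rotL-injective {u = []}    {[]}        _ = refl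
rotL-injective {u = []}    {_ ∷ []}    ()
rotL-injective {u = []}    {_ ∷ _ ∷ _} ()
rotL-injective {u = _ ∷ []}    {[]} ()
rotL-injective {u = _ ∷ _ ∷ _} {[]} ()
rotL-injective {u = c ∷ u} {d ∷ v} e with ∷ʳ-injective u v e
... | refl , refl = refl

rot-injective : ∀ i {u v : Word k} → rot i u ≡ rot i v → u ≡ v
rot-injective zero    e = e
rot-injective (suc i) e = rotL-injective (rot-injective i e)

infix 4 _∼_

_∼_ : Word k → Word k → Set
u ∼ v = ∃ λ i → rot i u ≡ v

∼-refl : {u : Word k} → u ∼ u
∼-refl = 0 , refl

∼-trans : {u v w : Word k} → u ∼ v → v ∼ w → u ∼ w
∼-trans {u = u} (i , refl) (j , refl) = i + j , rot-+ i j u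

∼-sym : {u v : Word k} → u ∼ v → v ∼ u
∼-sym {u = []}    (i , refl) = 0 , rot-[] i
∼-sym {u = c ∷ u} (i , refl) = i * length u , (begin
  rot (i * length u) (rot i (c ∷ u))   ≡⟨ sym (rot-+ i (i * length u) (c ∷ u)) ⟩
  rot (i + i * length u) (c ∷ u)       ≡⟨ cong (λ m → rot m (c ∷ u)) (sym (ℕ.*-suc i (length u))) ⟩
  rot (i * length (c ∷ u)) (c ∷ u)     ≡⟨ rot-*-period (rot-length (c ∷ u)) i ⟩
  c ∷ u                                ∎)
  where open ≡-Reasoning

∼-length : {u v : Word k} → u ∼ v → length v ≡ length u
∼-length {u = u} (i , refl) = length-rot i u

-- Colex order

infix 4 _<ˡ_ _≺_ _≼_

_<ˡ_ : Word k → Word k → Set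
_<ˡ_ = Lex-< _≡_ _<ᶠ_

-- Unlike _<colex_, this also compares words of different lengths.
record _≺_ (u v : Word k) : Set where
  constructor colex
  field
    reverse-<ˡ : reverse u <ˡ reverse v

_≼_ : Word k → Word k → Set
u ≼ v = u ≡ v ⊎ u ≺ v

≺-trans : {u v w : Word k} → u ≺ v → v ≺ w → u ≺ w
≺-trans (colex u<v) (colex v<w) = colex (<-transitive isEquivalence (resp₂ _<ᶠ_) FinP.<-trans u<v v<w)

≺-irrefl : {u : Word k} → ¬ u ≺ u
≺-irrefl (colex u<u) = <-irreflexive FinP.<-irrefl (≡⇒Pointwise-≡ refl) u<u

≺-asym : {u v : Word k} → u ≺ v → ¬ v ≺ u
≺-asym u≺v v≺u = ≺-irrefl (≺-trans u≺v v≺u)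

≺-cmp : (u v : Word k) → Tri (u ≺ v) (u ≡ v) (v ≺ u)
≺-cmp u v with <-compare sym FinP.<-cmp (reverse u) (reverse v)
... | tri< a ¬b ¬c = tri< (colex a) (λ u≡v → ¬b (≡⇒Pointwise-≡ (cong reverse u≡v))) (¬c ∘ _≺_.reverse-<ˡ)
... | tri≈ ¬a b ¬c = tri≈ (¬a ∘ _≺_.reverse-<ˡ) (reverse-injective (Pointwise-≡⇒≡ b)) (¬c ∘ _≺_.reverse-<ˡ)
... | tri> ¬a ¬b c = tri> (¬a ∘ _≺_.reverse-<ˡ) (λ u≡v → ¬b (≡⇒Pointwise-≡ (cong reverse u≡v))) (colex c)

≺-≼-trans : {u v w : Word k} → u ≺ v → v ≼ w → u ≺ w
≺-≼-trans u≺v (inj₁ refl) = u≺v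
≺-≼-trans u≺v (inj₂ v≺w)  = ≺-trans u≺v v≺w

≼-≺-trans : {u v w : Word k} → u ≼ v → v ≺ w → u ≺ w
≼-≺-trans (inj₁ refl) v≺w = v≺w
≼-≺-trans (inj₂ u≺v)  v≺w = ≺-trans u≺v v≺w

≼-antisym : {u v : Word k} → u ≼ v → v ≼ u → u ≡ v
≼-antisym (inj₁ u≡v) _           = u≡v
≼-antisym (inj₂ _)   (inj₁ v≡u)  = sym v≡u
≼-antisym (inj₂ u≺v) (inj₂ v≺u)  = ⊥-elim (≺-asym u≺v v≺u)

reverse-++-∷ : (y : Word k) (a : Fin k) (x : Word k) → reverse (y ++ a ∷ x) ≡ reverse x ++ a ∷ reverse y
reverse-++-∷ y a x = begin
  reverse (y ++ a ∷ x)           ≡⟨ reverse-++ y (a ∷ x) ⟩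
  reverse (a ∷ x) ++ reverse y   ≡⟨ cong (_++ reverse y) (unfold-reverse a x) ⟩
  (reverse x ∷ʳ a) ++ reverse y  ≡⟨ ++-assoc (reverse x) (a ∷ []) (reverse y) ⟩
  reverse x ++ a ∷ reverse y     ∎
  where open ≡-Reasoning

<ˡ-at : (p : Word k) {a b : Fin k} (s t : Word k) → a <ᶠ b → p ++ a ∷ s <ˡ p ++ b ∷ t
<ˡ-at []      s t a<b = this a<b
<ˡ-at (c ∷ p) s t a<b = next refl (<ˡ-at p s t a<b)

≺-at : (y₁ y₂ x : Word k) {a b : Fin k} → a <ᶠ b → y₁ ++ a ∷ x ≺ y₂ ++ b ∷ x
≺-at y₁ y₂ x {a} {b} a<b = colex (subst₂ _<ˡ_ (sym (reverse-++-∷ y₁ a x)) (sym (reverse-++-∷ y₂ b x))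
  (<ˡ-at (reverse x) (reverse y₁) (reverse y₂) a<b))

<ˡ-split : {xs ys : Word k} → xs <ˡ ys → length xs ≡ length ys →
  ∃ λ p → ∃ λ a → ∃ λ b → ∃ λ s → ∃ λ t → xs ≡ p ++ a ∷ s × ys ≡ p ++ b ∷ t × a <ᶠ b
<ˡ-split (base ())
<ˡ-split halt ()
<ˡ-split (this {x} {xs} {y} {ys} x<y) _ = [] , x , y , xs , ys , refl , refl , x<y
<ˡ-split (next {x} refl xs<ys) e with <ˡ-split xs<ys (ℕ.suc-injective e)
... | p , a , b , s , t , refl , refl , a<b = x ∷ p , a , b , s , t , refl , refl , a<b

≤colex⇒≼ : {u v : Word k} → u ≤colex v → u ≼ v
≤colex⇒≼ (_ , inj₁ u≡v) = inj₁ u≡v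
≤colex⇒≼ (_ , inj₂ (y₁ , y₂ , σ , τ , x , refl , refl , σ<τ)) = inj₂ (≺-at y₁ y₂ x σ<τ)

<colex⇒≺ : {u v : Word k} → u <colex v → u ≺ v
<colex⇒≺ (u≤v , u≢v) with ≤colex⇒≼ u≤v
... | inj₁ u≡v = ⊥-elim (u≢v u≡v)
... | inj₂ u≺v = u≺v

≼⇒≤colex : {u v : Word k} → length u ≡ length v → u ≼ v → u ≤colex v
≼⇒≤colex |u|≡|v| (inj₁ u≡v) = |u|≡|v| , inj₁ u≡v
≼⇒≤colex {u = u} {v} |u|≡|v| (inj₂ (colex u≺v))
  with <ˡ-split u≺v (trans (length-reverse u) (trans |u|≡|v| (sym (length-reverse v))))
... | p , a , b , s , t , ru , rv , a<b = |u|≡|v| , inj₂ (reverse s , reverse t , a , b , reverse p ,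
  unreverse u (trans (cong reverse ru) (reverse-++-∷ p a s)) ,
  unreverse v (trans (cong reverse rv) (reverse-++-∷ p b t)) , a<b)
  where
  unreverse : (w : Word k) {z : Word k} → reverse (reverse w) ≡ z → w ≡ z
  unreverse w e = trans (sym (reverse-involutive w)) e

-- Key words

zeros : ℕ → Word (suc k)
zeros n = replicate n fzero

rotL-zeros : ∀ n → rotL (zeros {k} n) ≡ zeros n
rotL-zeros zero    = refl
rotL-zeros (suc n) = zeros-∷ʳ n
  where
  zeros-∷ʳ : ∀ n → zeros {k} n ∷ʳ fzero ≡ fzero ∷ zeros n
  zeros-∷ʳ zero    = refl
  zeros-∷ʳ (suc n) = cong (fzero ∷_) (zeros-∷ʳ n)

rot-zeros : ∀ i n → rot i (zeros {k} n) ≡ zeros n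
rot-zeros zero    n = refl
rot-zeros (suc i) n = trans (cong (rot i) (rotL-zeros n)) (rot-zeros i n)

∼-zeros : ∀ n {x : Word (suc k)} → zeros n ∼ x → x ≡ zeros n
∼-zeros n (i , refl) = rot-zeros i n

reverse-zeros : ∀ n → reverse (zeros {k} n) ≡ zeros n
reverse-zeros zero    = refl
reverse-zeros (suc n) = begin
  reverse (fzero ∷ zeros n)   ≡⟨ unfold-reverse fzero (zeros n) ⟩
  reverse (zeros n) ∷ʳ fzero  ≡⟨ cong (_∷ʳ fzero) (reverse-zeros n) ⟩
  rotL (zeros (suc n))        ≡⟨ rotL-zeros (suc n) ⟩
  zeros (suc n)               ∎
  where open ≡-Reasoning

zeros-≡-or-<ˡ : (w : Word (suc k)) → zeros (length w) ≡ w ⊎ zeros (length w) <ˡ w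
zeros-≡-or-<ˡ []           = inj₁ refl
zeros-≡-or-<ˡ (fsuc c ∷ w) = inj₂ (this (s≤s z≤n))
zeros-≡-or-<ˡ (fzero ∷ w) with zeros-≡-or-<ˡ w
... | inj₁ zeros≡w = inj₁ (cong (fzero ∷_) zeros≡w)
... | inj₂ zeros<w = inj₂ (next refl zeros<w)

zeros-≼ : (u : Word (suc k)) → zeros (length u) ≼ u
zeros-≼ u with zeros-≡-or-<ˡ (reverse u) | trans (reverse-zeros (length u)) (cong zeros (sym (length-reverse u)))
... | inj₁ zeros≡ru | rz≡zeros = inj₁ (reverse-injective (trans rz≡zeros zeros≡ru))
... | inj₂ zeros<ru | rz≡zeros = inj₂ (colex (subst (_<ˡ reverse u) (sym rz≡zeros) zeros<ru))

key-≼ : ∀ {n} {K u : Word k} → IsKeyWord n K → K ∼ u → u ≼ K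
key-≼ {K = K} (_ , max) (i , refl) with rot-split i K
... | x , y , K≡xy , rotK≡yx = subst (_≼ K) (sym rotK≡yx) (≤colex⇒≼ (max x y K≡xy))

rotations-≼⇒key : ∀ {n} {u : Word k} → length u ≡ n → (∀ j → rot j u ≼ u) → IsKeyWord n u
rotations-≼⇒key {u = u} |u|≡n max = |u|≡n , λ x y u≡xy →
  let rot≡yx = trans (cong (rot (length x)) u≡xy) (rot-++ x y)
  in subst (_≤colex u) rot≡yx (≼⇒≤colex (length-rot (length x) u) (max (length x)))

zeros-key : ∀ n → IsKeyWord n (zeros {k} n)
zeros-key n = rotations-≼⇒key (length-replicate n) (λ j → inj₁ (rot-zeros j n))

key-unique : ∀ {n} {K₁ K₂ : Word k} → IsKeyWord n K₁ → IsKeyWord n K₂ → K₁ ∼ K₂ → K₁ ≡ K₂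
key-unique key₁ key₂ K₁∼K₂ = ≼-antisym (key-≼ key₂ (∼-sym K₁∼K₂)) (key-≼ key₁ K₁∼K₂)

bounded-max : (f : ℕ → Word k) → ∀ N → ∃ λ i → ∀ j → j < suc N → f j ≼ f i
bounded-max f zero = 0 , λ { _ (s≤s z≤n) → inj₁ refl }
bounded-max f (suc N) with bounded-max f N
... | i , max with ≺-cmp (f (suc N)) (f i)
...   | tri< new≺i _ _ = i , extend-< max (inj₂ new≺i)
...   | tri≈ _ new≡i _ = i , extend-< max (inj₁ new≡i)
...   | tri> _ _ i≺new = suc N , extend-< (λ j j<1+N → inj₂ (≼-≺-trans (max j j<1+N) i≺new)) (inj₁ refl)

key-of : ∀ {m} (u : Word k) → length u ≡ suc m → ∃ λ K → IsKeyWord (suc m) K × K ∼ u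
key-of {m = m} u |u|≡n with bounded-max (λ i → rot i u) m
... | i , max = rot i u , rotations-≼⇒key (trans (length-rot i u) |u|≡n) rot-≼ , ∼-sym (i , refl)
  where
  period : rot (suc m) u ≡ u
  period = subst (λ n → rot n u ≡ u) |u|≡n (rot-length u)
  rot-≼ : ∀ j → rot j (rot i u) ≼ rot i u
  rot-≼ j = subst (_≼ rot i u) (trans (sym (rot-%-period period (i + j))) (rot-+ i j u))
    (max ((i + j) % suc m) (m%n<n (i + j) (suc m)))

rot-pointwise : ∀ i (x : Word k) a b y →
  ∃ λ p → ∃ λ q → rot i (x ++ a ∷ y) ≡ p ++ a ∷ q × rot i (x ++ b ∷ y) ≡ p ++ b ∷ q
rot-pointwise zero    x       a b y = x , y , refl , refl
rot-pointwise (suc i) []      a b y = rot-pointwise i y a b []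
rot-pointwise (suc i) (c ∷ x) a b y with rot-pointwise i x a b (y ∷ʳ c)
... | p , q , e₁ , e₂ =
  p , q , trans (cong (rot i) (++-assoc x (a ∷ y) (c ∷ []))) e₁ ,
          trans (cong (rot i) (++-assoc x (b ∷ y) (c ∷ []))) e₂

insertion-point-≺ : ∀ {k n} l (s : Fin k) w → IsKeyWord n (zeros l ++ fsuc s ∷ w) →
  ∀ {u} → inject₁ s ∷ w ++ zeros l ∼ u → u ≺ zeros l ++ fsuc s ∷ w
insertion-point-≺ {k} l s w key (i , refl) with rot-pointwise i [] (inject₁ s) (fsuc s) (w ++ zeros l)
... | p , q , e₁ , e₂ = subst (_≺ K) (sym e₁) (≺-≼-trans (≺-at p p q inject₁<fsuc) (subst (_≼ K) e₂ (key-≼ key K∼)))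
  where
  K : Word (suc k)
  K = zeros l ++ fsuc s ∷ w
  inject₁<fsuc : inject₁ s <ᶠ fsuc s
  inject₁<fsuc = FinP.≤̄⇒inject₁< FinP.≤-refl
  K∼ : K ∼ rot i (fsuc s ∷ w ++ zeros l)
  K∼ = length (zeros {k} l) + i , trans (rot-+ (length (zeros l)) i K) (cong (rot i) (rot-++ (zeros l) (fsuc s ∷ w)))

-- Rotation cycles

Follows-rotL : ∀ {m} (u : Word k) → length u ≡ suc m → Follows u (rotL u)
Follows-rotL (c ∷ u) _ = c , u , c , refl , refl

Follows-∷ : {a b : Fin k} {v x : Word k} → Follows (a ∷ v) x → Follows (b ∷ v) x
Follows-∷ (_ , _ , σ , refl , refl) = _ , _ , σ , refl , refl

last-applyUpTo : {A : Set} (g : ℕ → A) (d : ℕ) → last (applyUpTo g (suc d)) ≡ just (g d)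
last-applyUpTo g zero    = refl
last-applyUpTo g (suc d) = last-applyUpTo (g ∘ suc) d

-- Names the local `go` of cycleFrom: the meta is solved by the with-abstraction in cycleFrom-unfold.
mutual
  cycleFrom-go : {k : ℕ} → Word k → ℕ → Word k → List (Word k)
  cycleFrom-go = _

  cycleFrom-unfold : (f : Word k) → cycleFrom f ≡ f ∷ cycleFrom-go f (length f) (rotL f)
  cycleFrom-unfold f with length f | rotL f
  ... | _ | _ = refl

cycleFrom-go-applyUpTo : ∀ (f : Word k) i g d → rot d g ≡ f → (∀ j → j < d → rot j g ≢ f) → d ≤ i →
  cycleFrom-go f i g ≡ applyUpTo (λ j → rot j g) d
cycleFrom-go-applyUpTo f zero    g zero    _ _ _ = refl
cycleFrom-go-applyUpTo f (suc i) g d rot≡f before d≤1+i with ≡-dec Fin._≟_ g f | d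
... | yes _   | zero   = refl
... | yes g≡f | suc _  = ⊥-elim (before 0 (s≤s z≤n) g≡f)
... | no  g≢f | zero   = ⊥-elim (g≢f rot≡f)
... | no  _   | suc d′ = cong (g ∷_)
  (cycleFrom-go-applyUpTo f i (rotL g) d′ rot≡f (λ j j<d′ → before (suc j) (s≤s j<d′)) (ℕ.≤-pred d≤1+i))

module _ {m} (f : Word k) (|f|≡1+m : length f ≡ suc m) where

  private
    least-period : ∃ λ d → d ≤ m × rot (suc d) f ≡ f × ∀ j → j < d → rot (suc j) f ≢ f
    least-period = least-witness (λ j → ≡-dec Fin._≟_ (rot (suc j) f) f)
      (subst (λ n → rot n f ≡ f) |f|≡1+m (rot-length f))

    d : ℕ
    d = proj₁ least-period

    period : rot (suc d) f ≡ f
    period = proj₁ (proj₂ (proj₂ least-period))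

    minimal : ∀ j → j < d → rot (suc j) f ≢ f
    minimal = proj₂ (proj₂ (proj₂ least-period))

    cycleFrom≡ : cycleFrom f ≡ applyUpTo (λ j → rot j f) (suc d)
    cycleFrom≡ = trans (cycleFrom-unfold f) (cong (f ∷_)
      (cycleFrom-go-applyUpTo f (length f) (rotL f) d period minimal
        (subst (d ≤_) (sym |f|≡1+m) (ℕ.m≤n⇒m≤1+n (proj₁ (proj₂ least-period))))))

  cycleFrom-unique : Unique (cycleFrom f)
  cycleFrom-unique rewrite cycleFrom≡ = Unique.applyUpTo⁺₁ (λ j → rot j f) (suc d) distinct
    where
    distinct : ∀ {i j} → i < j → j < suc d → rot i f ≢ rot j f
    distinct {i} {j} (s≤s i≤j′) (s≤s j≤d) rot-i≡rot-j = minimal δ δ<d (rot-injective i (begin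
      rot i (rot (suc δ) f)   ≡⟨ rot-comm i (suc δ) f ⟩
      rot (suc δ) (rot i f)   ≡⟨ sym (rot-+ i (suc δ) f) ⟩
      rot (i + suc δ) f       ≡⟨ cong (λ n → rot n f) i+1+δ≡j ⟩
      rot j f                 ≡⟨ sym rot-i≡rot-j ⟩
      rot i f                 ∎))
      where
      open ≡-Reasoning
      δ : ℕ
      δ = proj₁ (ℕ.m≤n⇒∃[o]m+o≡n i≤j′)
      i+1+δ≡j : i + suc δ ≡ j
      i+1+δ≡j = trans (ℕ.+-suc i δ) (cong suc (proj₂ (ℕ.m≤n⇒∃[o]m+o≡n i≤j′)))
      δ<d : δ < d
      δ<d = ℕ.<-≤-trans (subst (suc δ ≤_) i+1+δ≡j (ℕ.m≤n+m (suc δ) i)) j≤d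

  ∈-cycleFrom⁻ : ∀ {x} → x ∈ cycleFrom f → f ∼ x
  ∈-cycleFrom⁻ {x} x∈ with ∈-applyUpTo⁻ (λ j → rot j f) (subst (x ∈_) cycleFrom≡ x∈)
  ... | i , _ , x≡rot = i , sym x≡rot

  ∈-cycleFrom⁺ : ∀ {x} → f ∼ x → x ∈ cycleFrom f
  ∈-cycleFrom⁺ (j , refl) = subst (rot j f ∈_) (sym cycleFrom≡)
    (subst (_∈ applyUpTo (λ j → rot j f) (suc d)) (sym (rot-%-period period j))
      (∈-applyUpTo⁺ (λ j → rot j f) (m%n<n j (suc d))))

  cycleFrom-linked : Linked Follows (cycleFrom f)
  cycleFrom-linked rewrite cycleFrom≡ = Linkedₚ.applyUpTo⁺₂ (λ j → rot j f) (suc d) λ j →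
    subst (Follows (rot j f)) (sym (rot-suc j f)) (Follows-rotL (rot j f) (trans (length-rot j f) |f|≡1+m))

  cycleFrom-last : ∃ λ l → last (cycleFrom f) ≡ just l × rotL l ≡ f
  cycleFrom-last = rot d f , trans (cong last cycleFrom≡) (last-applyUpTo (λ j → rot j f) d) ,
    trans (sym (rot-suc d f)) period

head-++-∷ : {A : Set} (xs : List A) {t : A} (ys zs : List A) → head (xs ++ t ∷ ys) ≡ head (xs ++ t ∷ zs)
head-++-∷ []      _ _ = refl
head-++-∷ (_ ∷ _) _ _ = refl

head⇒∈ : {A : Set} (xs : List A) {x : A} → head xs ≡ just x → x ∈ xs
head⇒∈ (_ ∷ _) refl = here refl

AllPairs-++-∷⁻ : {A : Set} {R : A → A → Set} (xs : List A) {y : A} {ys : List A} →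
  AllPairs R (xs ++ y ∷ ys) → All (λ x → R x y) xs × All (R y) ys
AllPairs-++-∷⁻ []       (Ry ∷ _)   = [] , Ry
AllPairs-++-∷⁻ (x ∷ xs) (Rx ∷ Rxs) =
  All.lookup Rx (∈-++⁺ʳ xs (here refl)) ∷ proj₁ (AllPairs-++-∷⁻ xs Rxs) , proj₂ (AllPairs-++-∷⁻ xs Rxs)

splice-↭ : {A : Set} (xs : List A) (t : A) (C ys : List A) → xs ++ t ∷ C ++ ys ↭ C ++ xs ++ t ∷ ys
splice-↭ xs t C ys = begin
  xs ++ t ∷ C ++ ys       ↭⟨ Perm.++⁺ˡ xs (↭-sym (Perm.shift t C ys)) ⟩
  xs ++ C ++ t ∷ ys       ↭⟨ ↭-sym (Perm.++-assoc xs C (t ∷ ys)) ⟩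
  (xs ++ C) ++ t ∷ ys     ↭⟨ Perm.++⁺ʳ (t ∷ ys) (Perm.++-comm xs C) ⟩
  (C ++ xs) ++ t ∷ ys     ↭⟨ Perm.++-assoc C xs (t ∷ ys) ⟩
  C ++ xs ++ t ∷ ys       ∎
  where open PermutationReasoning

Unique-resp-↭ : {A : Set} {xs ys : List A} → xs ↭ ys → Unique xs → Unique ys
Unique-resp-↭ {A = A} xs↭ys = PermSetoid.Unique-resp-↭ (setoid A) (↭⇒↭ₛ xs↭ys)

Linked-splice : {A : Set} {R : A → A → Set} (xs : List A) {t l : A} (C ys : List A) →
  Connected R (just t) (head C) → last C ≡ just l → (∀ {y} → R t y → R l y) →
  Linked R C → Linked R (xs ++ t ∷ ys) → Linked R (xs ++ t ∷ C ++ ys)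
Linked-splice {R = R} [] {t} {l} (c ∷ cs) ys (just Rtc) lastC≡l Rt⇒Rl LC Lys =
  Rtc ∷ Linkedₚ.++⁺ LC (subst (λ m → Connected R m (head ys)) (sym lastC≡l) (connect ys Lys)) (Linked.tail Lys)
  where
  connect : ∀ ys → Linked R (t ∷ ys) → Connected R (just l) (head ys)
  connect []      _         = just-nothing
  connect (y ∷ _) (Rty ∷ _) = just (Rt⇒Rl Rty)
Linked-splice (x ∷ [])       C ys t↝C lastC Rt⇒Rl LC (Rxt ∷ L) =
  Rxt ∷ Linked-splice [] C ys t↝C lastC Rt⇒Rl LC L
Linked-splice (x ∷ x′ ∷ xs) C ys t↝C lastC Rt⇒Rl LC (Rxx′ ∷ L) =
  Rxx′ ∷ Linked-splice (x′ ∷ xs) C ys t↝C lastC Rt⇒Rl LC L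

Linked-∷ʳ⁻ : {A : Set} {R : A → A → Set} (xs : List A) {y : A} →
  Linked R (xs ∷ʳ y) → Linked R xs × (∀ {x} → last xs ≡ just x → R x y)
Linked-∷ʳ⁻ []            _         = [] , λ ()
Linked-∷ʳ⁻ (x ∷ [])      (Rxy ∷ _) = [-] , λ { refl → Rxy }
Linked-∷ʳ⁻ (x ∷ x′ ∷ xs) (R ∷ L)   = R ∷ proj₁ (Linked-∷ʳ⁻ (x′ ∷ xs) L) , proj₂ (Linked-∷ʳ⁻ (x′ ∷ xs) L)

insertAfter-∈ : {A : Set} (_≟_ : (a b : A) → Dec (a ≡ b)) (t : A) (C D : List A) → t ∈ D →
  ∃ λ xs → ∃ λ ys → D ≡ xs ++ t ∷ ys × insertAfter _≟_ t C D ≡ just (xs ++ t ∷ C ++ ys)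
insertAfter-∈ _≟_ t C (x ∷ D) t∈ with x ≟ t | t∈
... | yes refl | _          = [] , D , refl , refl
... | no  x≢t  | here t≡x   = ⊥-elim (x≢t (sym t≡x))
... | no  _    | there t∈D with insertAfter-∈ _≟_ t C D t∈D
...   | xs , ys , refl , e = x ∷ xs , ys , refl , cong (Maybe.map (x ∷_)) e

-- The construction

decomp-just : ∀ (K : Word (suc k)) {l s w} → decomp K ≡ just (l , s , w) → K ≡ zeros l ++ fsuc s ∷ w
decomp-just (fsuc _ ∷ _) refl = refl
decomp-just (fzero ∷ K) e with decomp K in eq
decomp-just (fzero ∷ K) refl | just _ = cong (fzero ∷_) (decomp-just K eq)

decomp-nothing : ∀ (K : Word (suc k)) → decomp K ≡ nothing → K ≡ zeros (length K)
decomp-nothing []          _ = refl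
decomp-nothing (fzero ∷ K) e with decomp K in eq
... | nothing = cong (fzero ∷_) (decomp-nothing K eq)

-- Condition (2) of a De Bruijn sequence is carried as the link from the last word back to 0ⁿ.
record Invariant (n : ℕ) (ks D : List (Word (suc k))) : Set where
  field
    head≡zeros : head D ≡ just (zeros n)
    unique     : Unique D
    linked     : Linked Follows (D ∷ʳ zeros n)
    ∈⇒∼key     : ∀ {x} → x ∈ D → ∃ λ K → K ∈ ks × K ∼ x
    ∼key⇒∈     : ∀ {x K} → K ∈ ks → K ∼ x → x ∈ D

splice-invariant : ∀ {m ks D xs ys} {K : Word (suc k)} (a b : Fin (suc k)) (v : Word (suc k)) →
  K ∼ v ∷ʳ b → length (v ∷ʳ b) ≡ suc m → (∀ {x} → v ∷ʳ b ∼ x → x ∈ D → ⊥) →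
  D ≡ xs ++ (a ∷ v) ∷ ys → Invariant (suc m) ks D →
  Invariant (suc m) (ks ∷ʳ K) (xs ++ (a ∷ v) ∷ cycleFrom (v ∷ʳ b) ++ ys)
splice-invariant {k} {m = m} {ks} {xs = xs} {ys} {K} a b v K∼f |f|≡1+m fresh refl inv = record
  { head≡zeros = trans (head-++-∷ xs (C ++ ys) ys) head≡zeros
  ; unique     = Unique-resp-↭ (↭-sym (splice-↭ xs t C ys))
                   (Unique.++⁺ (cycleFrom-unique f |f|≡1+m) unique λ (x∈C , x∈D) → fresh (∈-cycleFrom⁻ f |f|≡1+m x∈C) x∈D)
  ; linked     = subst (Linked Follows) (sym splice-∷ʳ)
                   (Linked-splice xs C (ys ∷ʳ zeros (suc m)) t↝f lastC≡l Follows-∷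
                     (cycleFrom-linked f |f|≡1+m) (subst (Linked Follows) (++-assoc xs (t ∷ ys) _) linked))
  ; ∈⇒∼key     = λ x∈ → ∈C++D⇒∼key (∈-++⁻ C (Perm.Any-resp-↭ (splice-↭ xs t C ys) x∈))
  ; ∼key⇒∈     = λ K′∈ K′∼x → Perm.Any-resp-↭ (↭-sym (splice-↭ xs t C ys)) (∼key⇒∈C++D (∈-++⁻ ks K′∈) K′∼x)
  }
  where
  open Invariant inv
  t f z : Word (suc k)
  t = a ∷ v
  f = v ∷ʳ b
  z = zeros (suc m)
  C : List (Word (suc k))
  C = cycleFrom f

  splice-∷ʳ : (xs ++ t ∷ C ++ ys) ∷ʳ z ≡ xs ++ t ∷ C ++ (ys ∷ʳ z)
  splice-∷ʳ = trans (++-assoc xs (t ∷ C ++ ys) (z ∷ [])) (cong (λ r → xs ++ t ∷ r) (++-assoc C ys (z ∷ [])))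

  t↝f : Connected Follows (just t) (head C)
  t↝f = subst (Connected Follows (just t)) (sym (cong head (cycleFrom-unfold f))) (just (a , v , b , refl , refl))

  ∈C++D⇒∼key : ∀ {x} → x ∈ C ⊎ x ∈ xs ++ t ∷ ys → ∃ λ K′ → K′ ∈ ks ∷ʳ K × K′ ∼ x
  ∈C++D⇒∼key (inj₁ x∈C) = K , ∈-++⁺ʳ ks (here refl) , ∼-trans K∼f (∈-cycleFrom⁻ f |f|≡1+m x∈C)
  ∈C++D⇒∼key (inj₂ x∈D) with ∈⇒∼key x∈D
  ... | K′ , K′∈ks , K′∼x = K′ , ∈-++⁺ˡ K′∈ks , K′∼x

  ∼key⇒∈C++D : ∀ {x K′} → K′ ∈ ks ⊎ K′ ∈ K ∷ [] → K′ ∼ x → x ∈ C ++ xs ++ t ∷ ys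
  ∼key⇒∈C++D (inj₁ K′∈ks)       K′∼x = ∈-++⁺ʳ C (∼key⇒∈ K′∈ks K′∼x)
  ∼key⇒∈C++D (inj₂ (here refl)) K∼x  = ∈-++⁺ˡ (∈-cycleFrom⁺ f |f|≡1+m (∼-trans (∼-sym K∼f) K∼x))

  lastC≡l : last C ≡ just (b ∷ v)
  lastC≡l with cycleFrom-last f |f|≡1+m
  ... | l , lastC , rotL-l≡f = trans lastC (cong just (rotL-injective rotL-l≡f))

step-invariant : ∀ {m ks D} {K : Word (suc k)} →
  (∀ {K′} → K′ ∈ ks → IsKeyWord (suc m) K′) → IsKeyWord (suc m) K →
  (∀ {K′} → K′ ∈ ks → K′ ≺ K) → (∀ {K′} → IsKeyWord (suc m) K′ → K′ ≺ K → K′ ∈ ks) →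
  Invariant (suc m) ks D → ∃ λ D′ → stepD (just D) K ≡ just D′ × Invariant (suc m) (ks ∷ʳ K) D′
step-invariant {k} {m} {ks} {D} {K} ks-keys K-key ks≺K ≺K⇒∈ks inv with decomp K in eq
... | nothing with Invariant.∈⇒∼key inv (head⇒∈ D (Invariant.head≡zeros inv))
...   | K′ , K′∈ks , K′∼zeros =
  ⊥-elim (≺-irrefl (subst₂ _≺_ (∼-zeros (suc m) (∼-sym K′∼zeros)) K≡zeros (ks≺K K′∈ks)))
  where
  K≡zeros : K ≡ zeros (suc m)
  K≡zeros = trans (decomp-nothing K eq) (cong zeros (proj₁ K-key))
step-invariant {k} {m} {ks} {D} {K} ks-keys K-key ks≺K ≺K⇒∈ks inv | just (l , s , w) with decomp-just K eq
... | refl =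
  let xs , ys , D≡ , inserted = insertAfter-∈ (≡-dec Fin._≟_) t (cycleFrom f) D t∈D
  in xs ++ t ∷ cycleFrom f ++ ys , inserted ,
     splice-invariant (inject₁ s) (fsuc s) v K∼f (trans (∼-length K∼f) (proj₁ K-key)) fresh D≡ inv
  where
  open Invariant inv
  v t f : Word (suc k)
  v = w ++ zeros l
  t = inject₁ s ∷ v
  f = v ∷ʳ fsuc s

  K∼b∷v : K ∼ fsuc s ∷ v
  K∼b∷v = length (zeros {k} l) , rot-++ (zeros l) (fsuc s ∷ w)

  K∼f : K ∼ f
  K∼f = ∼-trans K∼b∷v (1 , refl)

  t∈D : t ∈ D
  t∈D with key-of t (trans (∼-length K∼b∷v) (proj₁ K-key))
  ... | Kt , Kt-key , Kt∼t = ∼key⇒∈ (≺K⇒∈ks Kt-key (insertion-point-≺ l s w K-key (∼-sym Kt∼t))) Kt∼t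

  fresh : ∀ {x} → f ∼ x → x ∈ D → ⊥
  fresh f∼x x∈D with ∈⇒∼key x∈D
  ... | K′ , K′∈ks , K′∼x with key-unique (ks-keys K′∈ks) K-key (∼-trans K′∼x (∼-sym (∼-trans K∼f f∼x)))
  ...   | refl = ≺-irrefl (ks≺K K′∈ks)

module _ {m} {keys : List (Word (suc k))} (sorted : AllPairs _≺_ keys)
         (keys-complete : ∀ w → (w ∈ keys) ⇔ IsKeyWord (suc m) w) where

  private
    ∈keys⇒key : ∀ {w} → w ∈ keys → IsKeyWord (suc m) w
    ∈keys⇒key {w} = Equivalence.to (keys-complete w)

    key⇒∈keys : ∀ {w} → IsKeyWord (suc m) w → w ∈ keys
    key⇒∈keys {w} = Equivalence.from (keys-complete w)

  step-invariant-at : ∀ {ks K rest D} → keys ≡ ks ++ K ∷ rest → Invariant (suc m) ks D →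
    ∃ λ D′ → stepD (just D) K ≡ just D′ × Invariant (suc m) (ks ∷ʳ K) D′
  step-invariant-at {ks} {K} {rest} keys≡ = step-invariant ks-keys K-key (All.lookup ks≺K) ≺K⇒∈ks
    where
    ∈keys : ∀ {w} → w ∈ ks ++ K ∷ rest → w ∈ keys
    ∈keys {w} = subst (w ∈_) (sym keys≡)
    ks-keys : ∀ {K′} → K′ ∈ ks → IsKeyWord (suc m) K′
    ks-keys K′∈ks = ∈keys⇒key (∈keys (∈-++⁺ˡ K′∈ks))
    K-key : IsKeyWord (suc m) K
    K-key = ∈keys⇒key (∈keys (∈-++⁺ʳ ks (here refl)))
    ks≺K×K≺rest : All (_≺ K) ks × All (K ≺_) rest
    ks≺K×K≺rest = AllPairs-++-∷⁻ ks (subst (AllPairs _≺_) keys≡ sorted)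
    ks≺K : All (_≺ K) ks
    ks≺K = proj₁ ks≺K×K≺rest
    ≺K⇒∈ks : ∀ {K′} → IsKeyWord (suc m) K′ → K′ ≺ K → K′ ∈ ks
    ≺K⇒∈ks K′-key K′≺K with ∈-++⁻ ks (subst (_ ∈_) keys≡ (key⇒∈keys K′-key))
    ... | inj₁ K′∈ks           = K′∈ks
    ... | inj₂ (here refl)     = ⊥-elim (≺-irrefl K′≺K)
    ... | inj₂ (there K′∈rest) = ⊥-elim (≺-asym K′≺K (All.lookup (proj₂ ks≺K×K≺rest) K′∈rest))

  foldl-stepD-invariant : ∀ ks rest D → keys ≡ ks ++ rest → Invariant (suc m) ks D →
    ∃ λ D′ → foldl stepD (just D) rest ≡ just D′ × Invariant (suc m) keys D′
  foldl-stepD-invariant ks [] D keys≡ks inv =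
    D , refl , subst (λ ks → Invariant (suc m) ks D) (sym (trans keys≡ks (++-identityʳ ks))) inv
  foldl-stepD-invariant ks (K ∷ rest) D keys≡ inv with step-invariant-at keys≡ inv
  ... | D′ , stepped , inv′ rewrite stepped =
    foldl-stepD-invariant (ks ∷ʳ K) rest D′ (trans keys≡ (sym (++-assoc ks (K ∷ []) rest))) inv′

  invariant⇒DeBruijn : ∀ {D} → Invariant (suc m) keys D → IsDeBruijn (suc m) D
  invariant⇒DeBruijn {D} inv = unique , (λ w → mk⇔ (∈⇒length w) (length⇒∈ w)) , proj₁ closing , wraps
    where
    open Invariant inv
    closing : Linked Follows D × (∀ {l} → last D ≡ just l → Follows l (zeros (suc m)))
    closing = Linked-∷ʳ⁻ D linked
    ∈⇒length : ∀ w → w ∈ D → length w ≡ suc m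
    ∈⇒length w w∈D with ∈⇒∼key w∈D
    ... | K , K∈keys , K∼w = trans (∼-length K∼w) (proj₁ (∈keys⇒key K∈keys))
    length⇒∈ : ∀ w → length w ≡ suc m → w ∈ D
    length⇒∈ w |w|≡n with key-of w |w|≡n
    ... | K , K-key , K∼w = ∼key⇒∈ (key⇒∈keys K-key) K∼w
    wraps : ∀ f l → head D ≡ just f → last D ≡ just l → Follows l f
    wraps f l head≡f last≡l with trans (sym head≡f) head≡zeros
    ... | refl = proj₂ closing last≡l

  first-key≡zeros : ∀ {key₀ rest} → keys ≡ key₀ ∷ rest → key₀ ≡ zeros (suc m)
  first-key≡zeros {key₀} keys≡ with subst (zeros (suc m) ∈_) keys≡ (key⇒∈keys (zeros-key (suc m)))
                                  | subst (AllPairs _≺_) keys≡ sorted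
  ... | here zeros≡key₀  | _           = sym zeros≡key₀
  ... | there zeros∈rest | key₀≺ ∷ _ = ⊥-elim (≺-irrefl (≺-≼-trans (All.lookup key₀≺ zeros∈rest) zeros≼key₀))
    where
    |key₀|≡n : length key₀ ≡ suc m
    |key₀|≡n = proj₁ (∈keys⇒key (subst (key₀ ∈_) (sym keys≡) (here refl)))
    zeros≼key₀ : zeros (suc m) ≼ key₀
    zeros≼key₀ = subst (_≼ key₀) (cong zeros |key₀|≡n) (zeros-≼ key₀)

initial-invariant : ∀ {k} m → Invariant (suc m) (zeros (suc m) ∷ []) (zeros {k} (suc m) ∷ [])
initial-invariant {k} m = record
  { head≡zeros = refl
  ; unique     = [] ∷ []
  ; linked     = subst (Follows z) (rotL-zeros (suc m)) (Follows-rotL z (length-replicate (suc m))) ∷ [-]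
  ; ∈⇒∼key     = λ { (here refl) → zeros (suc m) , here refl , ∼-refl }
  ; ∼key⇒∈     = λ { (here refl) zeros∼x → here (∼-zeros (suc m) zeros∼x) }
  }
  where
  z : Word (suc k)
  z = zeros (suc m)

-- As for cycleFrom-go, this names the local `go` of buildD, which is foldl stepD.
mutual
  buildD-go : {k : ℕ} → ℕ → Word (suc k) → List (Word (suc k)) →
              Maybe (List (Word (suc k))) → List (Word (suc k)) → Maybe (List (Word (suc k)))
  buildD-go = _

  buildD-unfold : ∀ n (key₀ key₁ : Word (suc k)) rest → buildD (s≤s z≤n) n (key₀ ∷ key₁ ∷ rest) ≡
                  buildD-go n key₀ (key₁ ∷ rest) (stepD (just (zeros n ∷ [])) key₁) rest
  buildD-unfold n key₀ key₁ rest with key₁ ∷ rest | stepD (just (zeros n ∷ [])) key₁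
  ... | _ | _ = refl

buildD-go-foldl : ∀ n (key₀ : Word (suc k)) keys D rest → buildD-go n key₀ keys D rest ≡ foldl stepD D rest
buildD-go-foldl n key₀ keys D []         = refl
buildD-go-foldl n key₀ keys D (K ∷ rest) = buildD-go-foldl n key₀ keys (stepD D K) rest

buildD-foldl : ∀ n (key₀ : Word (suc k)) rest → buildD (s≤s z≤n) n (key₀ ∷ rest) ≡ foldl stepD (just (zeros n ∷ [])) rest
buildD-foldl n key₀ []           = refl
buildD-foldl n key₀ (key₁ ∷ rest) =
  trans (buildD-unfold n key₀ key₁ rest) (buildD-go-foldl n key₀ (key₁ ∷ rest) _ rest)

theorem2 : (n k : ℕ) → (n≥1 : 1 ≤ n) → (k≥1 : 1 ≤ k) →
    (keys : List (Word k)) → IsKeyList n keys →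
    ∃ λ D → buildD k≥1 n keys ≡ just D × IsDeBruijn n D
theorem2 (suc m) (suc k) (s≤s z≤n) (s≤s z≤n) [] (_ , complete)
  with Equivalence.from (complete (zeros (suc m))) (zeros-key (suc m))
... | ()
theorem2 (suc m) (suc k) (s≤s z≤n) (s≤s z≤n) (key₀ ∷ rest) (ordered , complete) =
  let D , built , inv = foldl-stepD-invariant sorted complete (key₀ ∷ []) rest (zeros (suc m) ∷ []) refl initial
  in D , trans (buildD-foldl (suc m) key₀ rest) built , invariant⇒DeBruijn sorted complete inv
  where
  sorted : AllPairs _≺_ (key₀ ∷ rest)
  sorted = Linkedₚ.Linked⇒AllPairs ≺-trans (Linked.map <colex⇒≺ ordered)
  initial : Invariant (suc m) (key₀ ∷ []) (zeros (suc m) ∷ [])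
  initial = subst (λ K → Invariant (suc m) (K ∷ []) _) (sym (first-key≡zeros sorted complete refl)) (initial-invariant m)
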